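{- Fix a universal prefix-free machine $U$. For any positive integers $k$ and $c$, there is no computable strong $k$-enumeration of the set of $c$-incompressible$_U$ strings.
   Context: $K_U(\rho)$ denotes the prefix-free Kolmogorov complexity of $\rho\in 2^{<\omega}$ with respect to $U$. A string $\rho$ is $c$-incompressible$_U$ iff $K_U(\rho)\geq|\rho|-c$. Let $D_n$ be the finite set of strings with canonical index $n$. For a set $S$ of strings, let $S_n$ be its set of strings of length $n$; a strong $k$-enumeration of $S$ is a function $h\in\omega^\omega$ such that for all $n$, $|D_{h(n)}|\leq k$ and $D_{h(n)}\cap S_n\neq\emptyset$. -}

module Defs where

open import Data.Nat using (ℕ; zero; suc; _+_; _*_; _∸_; _/_; _%_; _≤_)
open import Data.Nat.Properties using (_≟_)
open import Data.Bool using (Bool; true; false)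
open import Data.Fin using (Fin)
open import Data.Vec using (Vec; []; _∷_; lookup)
open import Data.List using (List; []; _∷_; _++_; length; filter; upTo)
open import Data.Maybe using (Maybe; just; nothing)
open import Data.Product using (Σ; _×_; ∃)
open import Relation.Binary.PropositionalEquality using (_≡_)
open import Function.Bundles using (_⇔_)
open import Relation.Nullary.Decidable using (⌊_⌋)
import Data.Bool

Str : Set
Str = List Bool

-- Standard effective bijection 2^{<ω} → ℕ (bijective base 2):
-- ε ↦ 0, 0σ ↦ 1 + 2·⌜σ⌝, 1σ ↦ 2 + 2·⌜σ⌝.
encode : Str → ℕ
encode []          = 0
encode (false ∷ σ) = 1 + 2 * encode σ
encode (true  ∷ σ) = 2 + 2 * encode σ

data Code : ℕ → Set where
  zer  : ∀ {n} → Code n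
  succ : Code 1
  proj : ∀ {n} → Fin n → Code n
  comp : ∀ {m n} → Code m → Vec (Code n) m → Code n
  prec : ∀ {n} → Code n → Code (suc (suc n)) → Code (suc n)
  mu   : ∀ {n} → Code (suc n) → Code n

mutual
  eval : ℕ → ∀ {n} → Code n → Vec ℕ n → Maybe ℕ
  eval zero     _          _  = nothing
  eval (suc f) zer         _  = just 0
  eval (suc f) succ  (x ∷ []) = just (suc x)
  eval (suc f) (proj i)    xs = just (lookup xs i)
  eval (suc f) (comp g hs) xs with evalVec f hs xs
  ... | nothing = nothing
  ... | just ys = eval f g ys
  eval (suc f) (prec g h) (x ∷ xs) = precAux f g h x xs
  eval (suc f) (mu g)      xs = muAux f g f 0 xs

  evalVec : ℕ → ∀ {m n} → Vec (Code n) m → Vec ℕ n → Maybe (Vec ℕ m)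
  evalVec f []       xs = just []
  evalVec f (h ∷ hs) xs with eval f h xs | evalVec f hs xs
  ... | just y | just ys = just (y ∷ ys)
  ... | _      | _       = nothing

  precAux : ℕ → ∀ {n} → Code n → Code (suc (suc n)) → ℕ → Vec ℕ n → Maybe ℕ
  precAux f g h zero    xs = eval f g xs
  precAux f g h (suc x) xs with precAux f g h x xs
  ... | nothing = nothing
  ... | just r  = eval f h (x ∷ r ∷ xs)

  -- search for the least y with g(y, xs) = 0 (all earlier values defined, ≠ 0),
  -- trying at most `k` further candidates
  muAux : ℕ → ∀ {n} → Code (suc n) → ℕ → ℕ → Vec ℕ n → Maybe ℕ
  muAux f g zero    y xs = nothing
  muAux f g (suc k) y xs with eval f g (y ∷ xs)
  ... | nothing      = nothing
  ... | just zero    = just y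
  ... | just (suc _) = muAux f g k (suc y) xs

_⇓_↦_ : ∀ {n} → Code n → Vec ℕ n → ℕ → Set
e ⇓ xs ↦ y = ∃ λ fuel → eval fuel e xs ≡ just y

Computable : (ℕ → ℕ) → Set
Computable h = Σ (Code 1) λ e → ∀ n → e ⇓ (n ∷ []) ↦ h n

-- Machines on strings: partial computable functions 2^{<ω} ⇀ 2^{<ω},
-- given by a code of arity 1 acting on the encodings.

Machine : Set
Machine = Code 1

Runs : Machine → Str → Str → Set
Runs M σ ρ = M ⇓ (encode σ ∷ []) ↦ encode ρ

Halts : Machine → Str → Set
Halts M σ = ∃ λ ρ → Runs M σ ρ

PrefixFree : Machine → Set
PrefixFree M = ∀ σ τ → Halts M σ → Halts M (σ ++ τ) → τ ≡ []

UniversalPF : Machine → Set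
UniversalPF U =
  PrefixFree U ×
  (∀ M → PrefixFree M →
     Σ Str λ ρM → ∀ τ ρ → Runs U (ρM ++ τ) ρ ⇔ Runs M τ ρ)

-- Prefix-free Kolmogorov complexity, via the predicate  K_U(ρ) ≥ m
-- (K_U(ρ) = min { |σ| : U(σ) = ρ }).

K≥ : Machine → Str → ℕ → Set
K≥ U ρ m = ∀ σ → Runs U σ ρ → m ≤ length σ

Incompressible : Machine → ℕ → Str → Set
Incompressible U c ρ = K≥ U ρ (length ρ ∸ c)

-- Canonical indices of finite sets.  A finite set of naturals X has
-- canonical index Σ_{x∈X} 2^x; strings are identified with naturals via
-- `encode`.

odd? : ℕ → Bool
odd? n = ⌊ n % 2 ≟ 1 ⌋

testBit : ℕ → ℕ → Bool
testBit n zero    = odd? n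
testBit n (suc i) = testBit (n / 2) i

-- the (codes of the) elements of D_n; all set bits of n are below n
Dcodes : ℕ → List ℕ
Dcodes n = filter (λ i → testBit n i Data.Bool.≟ true) (upTo n)

cardD : ℕ → ℕ
cardD n = length (Dcodes n)

_∈D_ : Str → ℕ → Set
σ ∈D n = testBit n (encode σ) ≡ true

StrongEnum : ℕ → (Str → Set) → (ℕ → ℕ) → Set
StrongEnum k S h =
  ∀ n → (cardD (h n) ≤ k) × (∃ λ σ → (σ ∈D h n) × (length σ ≡ n) × S σ)

module Submission where

-- From a code for h build, for every j, a prefix-free machine M_j
-- which, on the unary code 1^m 0 of m, outputs the j-th element (in the
-- order of codes) of the finite set D_{h(2m)}.  Universality gives
-- prefixes ρ_j with U(ρ_j 1^m 0) = M_j(1^m 0).  Let B = Σ_{j<k} |ρ_j| and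
-- m = c + B + 2.  The enumeration yields an incompressible σ ∈ D_{h(2m)}
-- of length 2m; σ is the j-th element of a set of size ≤ k, so j < k and
-- U describes σ with ρ_j 1^m 0, of length ≤ B + m + 1 < 2m - c.

open import Defs
open import Data.Bool using (Bool; true; false)
import Data.Bool
open import Data.Nat hiding (parity)
open import Data.Nat.Properties
open import Data.Nat.DivMod using (m%n<n; m/n*n≤m; m/n≡1+[m∸n]/n)
open import Data.Fin using (Fin; zero; suc)
open import Data.Vec using (Vec; []; _∷_; lookup)
open import Data.List using ([]; _∷_; _++_; length; filter; upTo; [_])
open import Data.List.Properties using (applyUpTo-∷ʳ; filter-++; length-++; filter-accept; filter-reject; ∷-injectiveʳ)
open import Data.Maybe using (just)
open import Data.Maybe.Properties using (just-injective)
open import Data.Product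
open import Data.Sum using (_⊎_; inj₁; inj₂)
open import Data.Empty using (⊥; ⊥-elim)
open import Function.Bundles using (Equivalence)
open import Relation.Nullary using (¬_; Dec)
open import Relation.Nullary.Decidable using (⌊_⌋)
open import Relation.Binary.PropositionalEquality hiding ([_])

-- (1) Convergence calculus.

mutual
  eval-step : ∀ f {n} (e : Code n) xs {y} →
              eval f e xs ≡ just y → eval (suc f) e xs ≡ just y
  eval-step zero    e           xs       ()
  eval-step (suc f) zer         xs       eq = eq
  eval-step (suc f) succ        (x ∷ []) eq = eq
  eval-step (suc f) (proj i)    xs       eq = eq
  eval-step (suc f) (comp g hs) xs       eq with evalVec f hs xs in ehs
  ... | just ys rewrite evalVec-step f hs xs ehs = eval-step f g ys eq
  eval-step (suc f) (prec g h)  (x ∷ xs) eq = precAux-step f g h x xs eq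
  eval-step (suc f) (mu g)      xs       eq = muAux-step f g f 0 xs eq

  evalVec-step : ∀ f {m n} (hs : Vec (Code n) m) xs {ys} →
                 evalVec f hs xs ≡ just ys → evalVec (suc f) hs xs ≡ just ys
  evalVec-step f []       xs eq = eq
  evalVec-step f (h ∷ hs) xs eq with eval f h xs in eh | evalVec f hs xs in ehs
  ... | just y | just ys rewrite eval-step f h xs eh | evalVec-step f hs xs ehs = eq

  precAux-step : ∀ f {n} (g : Code n) h x xs {y} →
                 precAux f g h x xs ≡ just y → precAux (suc f) g h x xs ≡ just y
  precAux-step f g h zero    xs eq = eval-step f g xs eq
  precAux-step f g h (suc x) xs eq with precAux f g h x xs in er
  ... | just r rewrite precAux-step f g h x xs er = eval-step f h _ eq

  -- the extra fuel also allows one more candidate in the search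
  muAux-step : ∀ f {n} (g : Code (suc n)) k y xs {r} →
               muAux f g k y xs ≡ just r → muAux (suc f) g (suc k) y xs ≡ just r
  muAux-step f g zero    y xs ()
  muAux-step f g (suc k) y xs eq with eval f g (y ∷ xs) in eg
  ... | just zero    rewrite eval-step f g (y ∷ xs) eg = eq
  ... | just (suc _) rewrite eval-step f g (y ∷ xs) eg = muAux-step f g k (suc y) xs eq

eval-mono : ∀ {f f'} {n} (e : Code n) xs {y} →
            f ≤ f' → eval f e xs ≡ just y → eval f' e xs ≡ just y
eval-mono {f} e xs le eq with m≤n⇒∃[o]m+o≡n le
... | d , refl = more d
  where
  more : ∀ d → eval (f + d) e xs ≡ just _
  more zero    rewrite +-identityʳ f = eq
  more (suc d) rewrite +-suc f d     = eval-step (f + d) e xs (more d)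

evalˡ : ∀ f f' {n} (e : Code n) xs {y} → eval f e xs ≡ just y → eval (f ⊔ f') e xs ≡ just y
evalˡ f f' e xs = eval-mono e xs (m≤m⊔n f f')

evalʳ : ∀ f f' {n} (e : Code n) xs {y} → eval f' e xs ≡ just y → eval (f ⊔ f') e xs ≡ just y
evalʳ f f' e xs = eval-mono e xs (m≤n⊔m f f')

⇓-det : ∀ {n} (e : Code n) xs {a b} → e ⇓ xs ↦ a → e ⇓ xs ↦ b → a ≡ b
⇓-det e xs (f₁ , e₁) (f₂ , e₂) =
  just-injective (trans (sym (evalˡ f₁ f₂ e xs e₁)) (evalʳ f₁ f₂ e xs e₂))

⇓-≡ : ∀ {n} {e : Code n} {xs a b} → a ≡ b → e ⇓ xs ↦ a → e ⇓ xs ↦ b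
⇓-≡ refl p = p

zer⇓ : ∀ {n} (xs : Vec ℕ n) → zer ⇓ xs ↦ 0
zer⇓ xs = 1 , refl

succ⇓ : ∀ x → succ ⇓ (x ∷ []) ↦ suc x
succ⇓ x = 1 , refl

proj⇓ : ∀ {n} (i : Fin n) xs → proj i ⇓ xs ↦ lookup xs i
proj⇓ i xs = 1 , refl

comp1⇓ : ∀ {n} (g : Code 1) (h : Code n) xs {z y} →
         h ⇓ xs ↦ z → g ⇓ (z ∷ []) ↦ y → comp g (h ∷ []) ⇓ xs ↦ y
comp1⇓ g h xs {y = y} (f₁ , e₁) (f₂ , e₂) = suc (f₁ ⊔ f₂) , converges
  where
  converges : eval (suc (f₁ ⊔ f₂)) (comp g (h ∷ [])) xs ≡ just y
  converges rewrite evalˡ f₁ f₂ h xs e₁ = evalʳ f₁ f₂ g _ e₂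

comp2⇓ : ∀ {n} (g : Code 2) (h₁ h₂ : Code n) xs {z₁ z₂ y} →
         h₁ ⇓ xs ↦ z₁ → h₂ ⇓ xs ↦ z₂ → g ⇓ (z₁ ∷ z₂ ∷ []) ↦ y →
         comp g (h₁ ∷ h₂ ∷ []) ⇓ xs ↦ y
comp2⇓ g h₁ h₂ xs {y = y} (f₁ , e₁) (f₂ , e₂) (f₃ , e₃) = suc (f₁ ⊔ f₂ ⊔ f₃) , converges
  where
  converges : eval (suc (f₁ ⊔ f₂ ⊔ f₃)) (comp g (h₁ ∷ h₂ ∷ [])) xs ≡ just y
  converges rewrite evalˡ (f₁ ⊔ f₂) f₃ h₁ xs (evalˡ f₁ f₂ h₁ xs e₁)
                  | evalˡ (f₁ ⊔ f₂) f₃ h₂ xs (evalʳ f₁ f₂ h₂ xs e₂)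
                  = evalʳ (f₁ ⊔ f₂) f₃ g _ e₃

prec⇓ : ∀ {n} (g : Code n) (h : Code (suc (suc n))) (R : ℕ → ℕ) xs →
        g ⇓ xs ↦ R 0 → (∀ x → h ⇓ (x ∷ R x ∷ xs) ↦ R (suc x)) →
        ∀ x → prec g h ⇓ (x ∷ xs) ↦ R x
prec⇓ g h R xs base step x with unfold x
  where
  unfold : ∀ x → ∃ λ f → precAux f g h x xs ≡ just (R x)
  unfold zero    = base
  unfold (suc x) with unfold x | step x
  ... | f₁ , e₁ | f₂ , e₂ = f₁ ⊔ f₂ , converges
    where
    converges : precAux (f₁ ⊔ f₂) g h (suc x) xs ≡ just (R (suc x))
    converges rewrite eval-mono (prec g h) (x ∷ xs) (s≤s (m≤m⊔n f₁ f₂)) e₁ = evalʳ f₁ f₂ h _ e₂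
... | f , e = suc f , e

module _ {n} (g : Code (suc n)) (xs : Vec ℕ n) where

  NonzeroWithin : ℕ → ℕ → Set
  NonzeroWithin f y = ∃ λ v → eval f g (y ∷ xs) ≡ just (suc v)

  commonFuel : ∀ r → (∀ y → y < r → ∃ λ v → g ⇓ (y ∷ xs) ↦ suc v) →
               ∃ λ f → ∀ y → y < r → NonzeroWithin f y
  commonFuel zero    _   = 0 , λ y ()
  commonFuel (suc r) pos with commonFuel r (λ y y<r → pos y (m<n⇒m<1+n y<r)) | pos r ≤-refl
  ... | f , below | v , f' , atr = f ⊔ f' , λ y y<1+r → combined (m≤n⇒m<n∨m≡n (s≤s⁻¹ y<1+r))
    where
    combined : ∀ {y} → y < r ⊎ y ≡ r → NonzeroWithin (f ⊔ f') y
    combined (inj₁ y<r)  = let (w , ew) = below _ y<r in w , evalˡ f f' g _ ew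
    combined (inj₂ refl) = v , evalʳ f f' g _ atr

  search : ∀ f k y₀ r → r < k + y₀ → y₀ ≤ r →
           (∀ y → y₀ ≤ y → y < r → NonzeroWithin f y) → eval f g (r ∷ xs) ≡ just 0 →
           muAux f g k y₀ xs ≡ just r
  search f zero    y₀ r r<y₀ y₀≤r _ _ = ⊥-elim (<⇒≱ r<y₀ y₀≤r)
  search f (suc k) y₀ r r<k+y₀ y₀≤r below atr with m≤n⇒m<n∨m≡n y₀≤r
  ... | inj₂ refl rewrite atr = refl
  ... | inj₁ y₀<r with below y₀ ≤-refl y₀<r
  ... | v , ev rewrite ev =
    search f k (suc y₀) r (subst (r <_) (sym (+-suc k y₀)) r<k+y₀) y₀<r
           (λ y 1+y₀≤y y<r → below y (<⇒≤ 1+y₀≤y) y<r) atr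

  -- with fuel suc F the search gets fuel F and F candidates; F is chosen
  -- to exceed r and the fuel of every evaluation involved
  mu⇓ : ∀ r → (∀ y → y < r → ∃ λ v → g ⇓ (y ∷ xs) ↦ suc v) → g ⇓ (r ∷ xs) ↦ 0 →
        mu g ⇓ xs ↦ r
  mu⇓ r pos (f₀ , atr) with commonFuel r pos
  ... | f , below = suc F , search F F 0 r r<F+0 z≤n
                              (λ y _ y<r → let (w , ew) = below y y<r in w , eval-mono g _ f≤F ew)
                              (eval-mono g _ f₀≤F atr)
    where
    F : ℕ
    F = f ⊔ f₀ ⊔ suc r
    f≤F : f ≤ F
    f≤F = ≤-trans (m≤m⊔n f f₀) (m≤m⊔n (f ⊔ f₀) (suc r))
    f₀≤F : f₀ ≤ F
    f₀≤F = ≤-trans (m≤n⊔m f f₀) (m≤m⊔n (f ⊔ f₀) (suc r))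
    r<F+0 : r < F + 0
    r<F+0 rewrite +-identityʳ F = m≤n⊔m (f ⊔ f₀) (suc r)

comp1-inv : ∀ {n} (g : Code 1) (h : Code n) xs {y} →
            comp g (h ∷ []) ⇓ xs ↦ y → ∃ λ z → (h ⇓ xs ↦ z) × (g ⇓ (z ∷ []) ↦ y)
comp1-inv g h xs (zero , ())
comp1-inv g h xs (suc f , eq) with eval f h xs in eh
... | just z = z , (f , eh) , (f , eq)

mu-inv : ∀ {n} (g : Code (suc n)) xs {r} → mu g ⇓ xs ↦ r → g ⇓ (r ∷ xs) ↦ 0
mu-inv g xs (zero , ())
mu-inv g xs (suc f , eq) = f , found f 0 eq
  where
  found : ∀ k y₀ {r} → muAux f g k y₀ xs ≡ just r → eval f g (r ∷ xs) ≡ just 0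
  found zero    y₀ ()
  found (suc k) y₀ eq with eval f g (y₀ ∷ xs) in eg
  found (suc k) y₀ refl | just zero = eg
  ... | just (suc _) = found k (suc y₀) eq

-- (2) Codes for arithmetic and bit extraction.

p₀ : ∀ {n} → Code (suc n)
p₀ = proj zero

p₁ : ∀ {n} → Code (suc (suc n))
p₁ = proj (suc zero)

p₂ : ∀ {n} → Code (suc (suc (suc n)))
p₂ = proj (suc (suc zero))

numeral : ∀ {n} → ℕ → Code n
numeral zero    = zer
numeral (suc j) = comp succ (numeral j ∷ [])

numeral⇓ : ∀ {n} j (xs : Vec ℕ n) → numeral j ⇓ xs ↦ j
numeral⇓ zero    xs = zer⇓ xs
numeral⇓ (suc j) xs = comp1⇓ succ (numeral j) xs (numeral⇓ j xs) (succ⇓ j)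

predC : Code 1
predC = prec zer p₀

pred⇓ : ∀ x → predC ⇓ (x ∷ []) ↦ pred x
pred⇓ = prec⇓ zer p₀ pred [] (zer⇓ []) (λ x → proj⇓ zero _)

-- truncated subtraction; the recursion runs over the subtrahend, which
-- is therefore the first argument
monusC : Code 2
monusC = prec p₀ (comp predC (p₁ ∷ []))

monus⇓ : ∀ y x → monusC ⇓ (y ∷ x ∷ []) ↦ (x ∸ y)
monus⇓ y x = prec⇓ p₀ _ (x ∸_) (x ∷ []) (proj⇓ zero _) step y
  where
  step : ∀ y → comp predC (p₁ ∷ []) ⇓ (y ∷ x ∸ y ∷ x ∷ []) ↦ (x ∸ suc y)
  step y = ⇓-≡ (pred[m∸n]≡m∸[1+n] x y)
                 (comp1⇓ predC p₁ _ (proj⇓ _ _) (pred⇓ (x ∸ y)))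

addC : Code 2
addC = prec p₀ (comp succ (p₁ ∷ []))

add⇓ : ∀ a b → addC ⇓ (a ∷ b ∷ []) ↦ (a + b)
add⇓ a b = prec⇓ p₀ _ (_+ b) (b ∷ []) (proj⇓ zero _)
                 (λ a → comp1⇓ succ p₁ _ (proj⇓ _ _) (succ⇓ (a + b))) a

-- the distance, which vanishes exactly on equal arguments, serves as an
-- equality test
monus-sum≡∣-∣ : ∀ a b → (a ∸ b) + (b ∸ a) ≡ ∣ a - b ∣
monus-sum≡∣-∣ zero    zero    = refl
monus-sum≡∣-∣ zero    (suc b) = refl
monus-sum≡∣-∣ (suc a) zero    = +-identityʳ (suc a)
monus-sum≡∣-∣ (suc a) (suc b) = monus-sum≡∣-∣ a b

distC : Code 2
distC = comp addC (comp monusC (p₁ ∷ p₀ ∷ []) ∷ monusC ∷ [])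

dist⇓ : ∀ a b → distC ⇓ (a ∷ b ∷ []) ↦ ∣ a - b ∣
dist⇓ a b = ⇓-≡ (monus-sum≡∣-∣ a b)
  (comp2⇓ addC _ monusC _
     (comp2⇓ monusC p₁ p₀ _ (proj⇓ _ _) (proj⇓ _ _) (monus⇓ b a))
     (monus⇓ a b) (add⇓ _ _))

-- Parity, halving and right shifts, defined by the recursions the codes
-- below implement.
parity : ℕ → ℕ
parity zero    = 0
parity (suc x) = 1 ∸ parity x

halve : ℕ → ℕ
halve zero    = 0
halve (suc x) = halve x + parity x

shiftR : ℕ → ℕ → ℕ
shiftR zero    x = x
shiftR (suc i) x = halve (shiftR i x)

parityC : Code 1
parityC = prec zer (comp monusC (p₁ ∷ numeral 1 ∷ []))

parity⇓ : ∀ x → parityC ⇓ (x ∷ []) ↦ parity x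
parity⇓ = prec⇓ zer _ parity [] (zer⇓ [])
            (λ x → comp2⇓ monusC p₁ (numeral 1) _ (proj⇓ _ _) (numeral⇓ 1 _) (monus⇓ _ 1))

halveC : Code 1
halveC = prec zer (comp addC (p₁ ∷ comp parityC (p₀ ∷ []) ∷ []))

halve⇓ : ∀ x → halveC ⇓ (x ∷ []) ↦ halve x
halve⇓ = prec⇓ zer _ halve [] (zer⇓ [])
           (λ x → comp2⇓ addC p₁ _ _ (proj⇓ _ _)
                    (comp1⇓ parityC p₀ _ (proj⇓ _ _) (parity⇓ x)) (add⇓ _ _))

shiftC : Code 2
shiftC = prec p₀ (comp halveC (p₁ ∷ []))

shift⇓ : ∀ i x → shiftC ⇓ (i ∷ x ∷ []) ↦ shiftR i x
shift⇓ i x = prec⇓ p₀ _ (λ i → shiftR i x) (x ∷ []) (proj⇓ _ _)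
               (λ i → comp1⇓ halveC p₁ _ (proj⇓ _ _) (halve⇓ _)) i

bitC : Code 2
bitC = comp parityC (shiftC ∷ [])

bitValue : Bool → ℕ
bitValue true  = 1
bitValue false = 0

parity≤1 : ∀ x → parity x ≤ 1
parity≤1 zero    = z≤n
parity≤1 (suc x) = m∸n≤m 1 (parity x)

parity≡%2 : ∀ x → parity x ≡ x % 2
parity≡%2 zero          = refl
parity≡%2 (suc zero)    = refl
parity≡%2 (suc (suc x)) = trans (m∸[m∸n]≡n (parity≤1 x)) (parity≡%2 x)

halve≡/2 : ∀ x → halve x ≡ x / 2
halve≡/2 zero          = refl
halve≡/2 (suc zero)    = refl
halve≡/2 (suc (suc x)) = begin
  halve x + parity x + (1 ∸ parity x)   ≡⟨ +-assoc (halve x) (parity x) _ ⟩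
  halve x + (parity x + (1 ∸ parity x)) ≡⟨ cong (halve x +_) (m+[n∸m]≡n (parity≤1 x)) ⟩
  halve x + 1                           ≡⟨ +-comm (halve x) 1 ⟩
  suc (halve x)                         ≡⟨ cong suc (halve≡/2 x) ⟩
  suc (x / 2)                           ≡⟨ m/n≡1+[m∸n]/n {suc (suc x)} {2} (s≤s (s≤s z≤n)) ⟨
  suc (suc x) / 2                       ∎
  where open ≡-Reasoning

shiftR-halve : ∀ i x → shiftR i (halve x) ≡ halve (shiftR i x)
shiftR-halve zero    x = refl
shiftR-halve (suc i) x = cong halve (shiftR-halve i x)

lowBit : ∀ x → parity x ≡ bitValue (testBit x 0)
lowBit x = trans (parity≡%2 x) (sym (bitValue-odd (x % 2) (m%n<n x 2)))
  where
  bitValue-odd : ∀ r → r < 2 → bitValue ⌊ r ≟ 1 ⌋ ≡ r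
  bitValue-odd zero          _ = refl
  bitValue-odd (suc zero)    _ = refl
  bitValue-odd (suc (suc r)) (s≤s (s≤s ()))

bit≡testBit : ∀ i x → parity (shiftR i x) ≡ bitValue (testBit x i)
bit≡testBit zero    x = lowBit x
bit≡testBit (suc i) x = begin
  parity (halve (shiftR i x)) ≡⟨ cong parity (shiftR-halve i x) ⟨
  parity (shiftR i (halve x)) ≡⟨ cong (λ y → parity (shiftR i y)) (halve≡/2 x) ⟩
  parity (shiftR i (x / 2))   ≡⟨ bit≡testBit i (x / 2) ⟩
  bitValue (testBit x (suc i)) ∎
  where open ≡-Reasoning

bit⇓ : ∀ i x → bitC ⇓ (i ∷ x ∷ []) ↦ bitValue (testBit x i)
bit⇓ i x = ⇓-≡ (bit≡testBit i x) (comp1⇓ parityC shiftC _ (shift⇓ i x) (parity⇓ _))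

-- (3) Ranks in a canonical index and the selector codes.

-- rank x b: the number of set bits of x below position b.  Since every
-- set bit of x lies below x, rank x x is (by definition) the size cardD x.
hasBit? : (x i : ℕ) → Dec (testBit x i ≡ true)
hasBit? x i = testBit x i Data.Bool.≟ true

rank : ℕ → ℕ → ℕ
rank x b = length (filter (hasBit? x) (upTo b))

-- the recursion computed by rankC: passing position b adds bit b
rank-suc : ∀ x b → rank x (suc b) ≡ rank x b + bitValue (testBit x b)
rank-suc x b = begin
  length (filter (hasBit? x) (upTo (suc b)))
    ≡⟨ cong (λ l → length (filter (hasBit? x) l)) (sym (applyUpTo-∷ʳ (λ i → i) b)) ⟩
  length (filter (hasBit? x) (upTo b ++ [ b ]))
    ≡⟨ cong length (filter-++ (hasBit? x) (upTo b) [ b ]) ⟩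
  length (filter (hasBit? x) (upTo b) ++ filter (hasBit? x) [ b ])
    ≡⟨ length-++ (filter (hasBit? x) (upTo b)) ⟩
  rank x b + length (filter (hasBit? x) [ b ])
    ≡⟨ cong (rank x b +_) (lastBit (testBit x b) refl) ⟩
  rank x b + bitValue (testBit x b) ∎
  where
  open ≡-Reasoning
  lastBit : ∀ t → testBit x b ≡ t → length (filter (hasBit? x) [ b ]) ≡ bitValue t
  lastBit true  set   = cong length (filter-accept (hasBit? x) {x = b} {xs = []} set)
  lastBit false unset = cong length (filter-reject (hasBit? x) {x = b} {xs = []} (λ set → false≢true (trans (sym unset) set)))
    where
    false≢true : false ≢ true
    false≢true ()

rank-mono : ∀ x {a b} → a ≤ b → rank x a ≤ rank x b
rank-mono x {b = zero}  z≤n  = ≤-refl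
rank-mono x {b = suc b} a≤1+b with m≤n⇒m<n∨m≡n a≤1+b
... | inj₂ refl = ≤-refl
... | inj₁ a<1+b = ≤-trans (rank-mono x (s≤s⁻¹ a<1+b))
                           (subst (rank x b ≤_) (sym (rank-suc x b)) (m≤m+n (rank x b) _))

rank-set : ∀ x b → testBit x b ≡ true → rank x (suc b) ≡ suc (rank x b)
rank-set x b set = trans (rank-suc x b) (trans (cong (λ t → rank x b + bitValue t) set)
                                               (+-comm (rank x b) 1))

testBit⇒< : ∀ x i → testBit x i ≡ true → i < x
testBit⇒< zero    zero    ()
testBit⇒< (suc x) zero    _   = s≤s z≤n
testBit⇒< x       (suc i) set = ≤-trans 2+2i≤x/2*2 (m/n*n≤m x 2)
  where
  2+2i≤x/2*2 : suc (suc i) ≤ x / 2 * 2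
  2+2i≤x/2*2 = ≤-trans (s≤s (s≤s (m≤m*n i 2))) (*-monoˡ-≤ 2 (testBit⇒< (x / 2) i set))

rank<cardD : ∀ x b → testBit x b ≡ true → rank x b < cardD x
rank<cardD x b set = begin-strict
  rank x b       <⟨ n<1+n (rank x b) ⟩
  suc (rank x b) ≡⟨ rank-set x b set ⟨
  rank x (suc b) ≤⟨ rank-mono x (testBit⇒< x b set) ⟩
  rank x x       ∎
  where open ≤-Reasoning

rankC : Code 2
rankC = prec zer (comp addC (p₁ ∷ comp bitC (p₀ ∷ p₂ ∷ []) ∷ []))

rank⇓ : ∀ b x → rankC ⇓ (b ∷ x ∷ []) ↦ rank x b
rank⇓ b x = prec⇓ zer _ (rank x) (x ∷ []) (zer⇓ _) step b
  where
  step : ∀ b → comp addC (p₁ ∷ comp bitC (p₀ ∷ p₂ ∷ []) ∷ []) ⇓ (b ∷ rank x b ∷ x ∷ []) ↦ rank x (suc b)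
  step b = ⇓-≡ (sym (rank-suc x b))
             (comp2⇓ addC p₁ _ _ (proj⇓ _ _)
                (comp2⇓ bitC p₀ p₂ _ (proj⇓ _ _) (proj⇓ _ _) (bit⇓ b x)) (add⇓ _ _))

-- selectC j returns the element of rank j of D_x: the least y at which
-- rank x (y + 1) reaches j + 1, i.e. the least zero of rankGap j.
rankGapC : ℕ → Code 2
rankGapC j = comp monusC (comp rankC (comp succ (p₀ ∷ []) ∷ p₁ ∷ []) ∷ numeral (suc j) ∷ [])

rankGap⇓ : ∀ j y x → rankGapC j ⇓ (y ∷ x ∷ []) ↦ (suc j ∸ rank x (suc y))
rankGap⇓ j y x =
  comp2⇓ monusC _ (numeral (suc j)) _
    (comp2⇓ rankC _ p₁ _ (comp1⇓ succ p₀ _ (proj⇓ _ _) (succ⇓ y)) (proj⇓ _ _) (rank⇓ (suc y) x))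
    (numeral⇓ (suc j) _) (monus⇓ _ _)

selectC : ℕ → Code 1
selectC j = mu (rankGapC j)

select⇓ : ∀ x b → testBit x b ≡ true → selectC (rank x b) ⇓ (x ∷ []) ↦ b
select⇓ x b set = mu⇓ (rankGapC j) (x ∷ []) b below (⇓-≡ reached (rankGap⇓ j b x))
  where
  j : ℕ
  j = rank x b
  -- below b the rank has not yet passed j
  below : ∀ y → y < b → ∃ λ v → rankGapC j ⇓ (y ∷ x ∷ []) ↦ suc v
  below y y<b = j ∸ rank x (suc y) , ⇓-≡ (+-∸-assoc 1 (rank-mono x y<b)) (rankGap⇓ j y x)
  reached : suc j ∸ rank x (suc b) ≡ 0
  reached = trans (cong (suc j ∸_) (rank-set x b set)) (n∸n≡0 (suc j))

-- (4) Unary codes 1^m 0: a prefix-free set of strings, decoded by a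
-- partial code defined exactly on their encodings.

unary : ℕ → Str
unary zero    = false ∷ []
unary (suc m) = true ∷ unary m

length-unary : ∀ m → length (unary m) ≡ suc m
length-unary zero    = refl
length-unary (suc m) = cong suc (length-unary m)

unary-injective : ∀ a b → unary a ≡ unary b → a ≡ b
unary-injective zero    zero    _  = refl
unary-injective zero    (suc b) ()
unary-injective (suc a) zero    ()
unary-injective (suc a) (suc b) eq = cong suc (unary-injective a b (∷-injectiveʳ eq))

unary-prefixFree : ∀ a b τ → unary a ++ τ ≡ unary b → τ ≡ []
unary-prefixFree zero    zero    τ eq = ∷-injectiveʳ eq
unary-prefixFree zero    (suc b) τ ()
unary-prefixFree (suc a) zero    τ ()
unary-prefixFree (suc a) (suc b) τ eq = unary-prefixFree a b τ (∷-injectiveʳ eq)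

encode-injective : ∀ σ τ → encode σ ≡ encode τ → σ ≡ τ
encode-injective []          []          _  = refl
encode-injective []          (false ∷ τ) ()
encode-injective []          (true  ∷ τ) ()
encode-injective (false ∷ σ) []          ()
encode-injective (true  ∷ σ) []          ()
encode-injective (false ∷ σ) (false ∷ τ) eq =
  cong (false ∷_) (encode-injective σ τ (*-cancelˡ-≡ _ _ 2 (suc-injective eq)))
encode-injective (true  ∷ σ) (true  ∷ τ) eq =
  cong (true ∷_) (encode-injective σ τ (*-cancelˡ-≡ _ _ 2 (suc-injective (suc-injective eq))))
encode-injective (false ∷ σ) (true  ∷ τ) eq =
  ⊥-elim (even≢odd (encode σ) (encode τ) (suc-injective eq))
encode-injective (true  ∷ σ) (false ∷ τ) eq =
  ⊥-elim (even≢odd (encode τ) (encode σ) (sym (suc-injective eq)))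

-- m ↦ encode (unary m), via encode (1σ) = 2 + 2·encode σ
unaryStepC : Code 2
unaryStepC = comp succ (comp succ (comp addC (p₁ ∷ comp addC (p₁ ∷ zer ∷ []) ∷ []) ∷ []) ∷ [])

unaryC : Code 1
unaryC = prec (numeral 1) unaryStepC

unary⇓ : ∀ m → unaryC ⇓ (m ∷ []) ↦ encode (unary m)
unary⇓ = prec⇓ (numeral 1) unaryStepC (λ m → encode (unary m)) [] (numeral⇓ 1 []) step
  where
  step : ∀ m → unaryStepC ⇓ (m ∷ encode (unary m) ∷ []) ↦ encode (unary (suc m))
  step m = comp1⇓ succ _ _ (comp1⇓ succ _ _
             (comp2⇓ addC p₁ _ _ (proj⇓ _ _)
                (comp2⇓ addC p₁ zer _ (proj⇓ _ _) (zer⇓ _) (add⇓ _ 0)) (add⇓ _ _))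
             (succ⇓ _)) (succ⇓ _)

decodeTestC : Code 2
decodeTestC = comp distC (comp unaryC (p₀ ∷ []) ∷ p₁ ∷ [])

decodeC : Code 1
decodeC = mu decodeTestC

decodeTest⇓ : ∀ m e → decodeTestC ⇓ (m ∷ e ∷ []) ↦ ∣ encode (unary m) - e ∣
decodeTest⇓ m e = comp2⇓ distC _ p₁ _ (comp1⇓ unaryC p₀ _ (proj⇓ _ _) (unary⇓ m)) (proj⇓ _ _) (dist⇓ _ _)

decode⇓ : ∀ m → decodeC ⇓ (encode (unary m) ∷ []) ↦ m
decode⇓ m = mu⇓ decodeTestC _ m below (⇓-≡ (∣n-n∣≡0 (encode (unary m))) (decodeTest⇓ m _))
  where
  nonzero : ∀ d → d ≢ 0 → ∃ λ v → d ≡ suc v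
  nonzero zero    d≢0 = ⊥-elim (d≢0 refl)
  nonzero (suc v) _   = v , refl
  below : ∀ y → y < m → ∃ λ v → decodeTestC ⇓ (y ∷ encode (unary m) ∷ []) ↦ suc v
  below y y<m with nonzero _ (λ d≡0 → <⇒≢ y<m (unary-injective y m
                     (encode-injective _ _ (∣m-n∣≡0⇒m≡n d≡0))))
  ... | v , d≡1+v = v , ⇓-≡ d≡1+v (decodeTest⇓ y _)

decode-inv : ∀ σ {m} → decodeC ⇓ (encode σ ∷ []) ↦ m → σ ≡ unary m
decode-inv σ {m} p = sym (encode-injective _ σ (∣m-n∣≡0⇒m≡n
  (⇓-det decodeTestC (m ∷ encode σ ∷ []) (decodeTest⇓ m (encode σ)) (mu-inv _ _ p))))

-- (5) The machines M_j(1^m 0) = (element of rank j of D_{h(2m)}), for a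
-- code hc of h.

doubleC : Code 1
doubleC = comp addC (p₀ ∷ p₀ ∷ [])

double⇓ : ∀ m → doubleC ⇓ (m ∷ []) ↦ (m + m)
double⇓ m = comp2⇓ addC p₀ p₀ _ (proj⇓ _ _) (proj⇓ _ _) (add⇓ m m)

module _ (hc : Code 1) where

  machine : ℕ → Machine
  machine j = comp (selectC j) (comp hc (comp doubleC (decodeC ∷ []) ∷ []) ∷ [])

  machine-halts⇒unary : ∀ j σ → Halts (machine j) σ → ∃ λ m → σ ≡ unary m
  machine-halts⇒unary j σ (_ , run) with comp1-inv (selectC j) _ _ run
  ... | _ , hcDouble , _ with comp1-inv hc _ _ hcDouble
  ... | _ , double , _   with comp1-inv doubleC decodeC _ double
  ... | m , decoded , _  = m , decode-inv σ decoded

  machine-prefixFree : ∀ j → PrefixFree (machine j)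
  machine-prefixFree j σ τ halts halts' =
    extension-empty (machine-halts⇒unary j σ halts) (machine-halts⇒unary j (σ ++ τ) halts')
    where
    extension-empty : (∃ λ a → σ ≡ unary a) → (∃ λ b → σ ++ τ ≡ unary b) → τ ≡ []
    extension-empty (a , σ≡) (b , σ++τ≡) =
      unary-prefixFree a b τ (trans (cong (_++ τ) (sym σ≡)) σ++τ≡)

  machine-covers : (h : ℕ → ℕ) → (∀ n → hc ⇓ (n ∷ []) ↦ h n) →
                   ∀ m σ → σ ∈D h (m + m) →
                   ∃ λ j → (j < cardD (h (m + m))) × Runs (machine j) (unary m) σ
  machine-covers h hc-computes m σ σ∈ =
    rank (h (m + m)) (encode σ) ,
    rank<cardD (h (m + m)) (encode σ) σ∈ ,
    comp1⇓ (selectC _) _ _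
      (comp1⇓ hc _ _ (comp1⇓ doubleC decodeC _ (decode⇓ m) (double⇓ m)) (hc-computes (m + m)))
      (select⇓ (h (m + m)) (encode σ) σ∈)

-- (6) The counting argument.

totalLength : (ℕ → Str) → ℕ → ℕ
totalLength ρ zero    = 0
totalLength ρ (suc k) = length (ρ k) + totalLength ρ k

length≤totalLength : ∀ ρ {j k} → j < k → length (ρ j) ≤ totalLength ρ k
length≤totalLength ρ {j} {suc k} j<1+k with m≤n⇒m<n∨m≡n (s≤s⁻¹ j<1+k)
... | inj₂ refl = m≤m+n _ _
... | inj₁ j<k  = ≤-trans (length≤totalLength ρ j<k) (m≤n+m _ _)

-- for m ≥ c + L + 2, a c-incompressible string of length 2m has no
-- description of length L + m + 1, as 2m ∸ c > L + m + 1
tooShort : ∀ {c L m} → c + suc (suc L) ≤ m → ¬ ((m + m) ∸ c ≤ L + suc m)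
tooShort {c} {L} {m} c+2+L≤m short = 1+n≰n (begin
  suc (suc (L + m))           ≡⟨ m+n∸m≡n c _ ⟨
  c + (suc (suc L) + m) ∸ c   ≡⟨ cong (_∸ c) (+-assoc c (suc (suc L)) m) ⟨
  c + suc (suc L) + m ∸ c     ≤⟨ ∸-monoˡ-≤ c (+-monoˡ-≤ m c+2+L≤m) ⟩
  m + m ∸ c                   ≤⟨ short ⟩
  L + suc m                   ≡⟨ +-suc L m ⟩
  suc (L + m)                 ∎)
  where open ≤-Reasoning

shortDescription : (U : Machine) (M : ℕ → Machine) (ρ : ℕ → Str) →
                   (∀ j τ σ → Runs (M j) τ σ → Runs U (ρ j ++ τ) σ) →
                   ∀ {k c m j σ} → j < k → Runs (M j) (unary m) σ → Incompressible U c σ →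
                   length σ ∸ c ≤ totalLength ρ k + suc m
shortDescription U M ρ simulates {k} {c} {m} {j} {σ} j<k runsM incompressible = begin
  length σ ∸ c                     ≤⟨ incompressible (ρ j ++ unary m) (simulates j (unary m) σ runsM) ⟩
  length (ρ j ++ unary m)          ≡⟨ length-++ (ρ j) ⟩
  length (ρ j) + length (unary m)  ≡⟨ cong (length (ρ j) +_) (length-unary m) ⟩
  length (ρ j) + suc m             ≤⟨ +-monoˡ-≤ (suc m) (length≤totalLength ρ j<k) ⟩
  totalLength ρ k + suc m          ∎
  where open ≤-Reasoning

lemma4 : (U : Machine) → UniversalPF U →
         (k c : ℕ) → 1 ≤ k → 1 ≤ c →
         ¬ (Σ (ℕ → ℕ) λ h → Computable h × StrongEnum k (Incompressible U c) h)
lemma4 U (_ , universal) k c _ _ (h , (hc , hc-computes) , enumerates) =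
  refuted (enumerates (m + m))
  where
  ρ : ℕ → Str
  ρ j = proj₁ (universal (machine hc j) (machine-prefixFree hc j))
  simulates : ∀ j τ σ → Runs (machine hc j) τ σ → Runs U (ρ j ++ τ) σ
  simulates j τ σ = Equivalence.from (proj₂ (universal (machine hc j) (machine-prefixFree hc j)) τ σ)
  m : ℕ
  m = c + suc (suc (totalLength ρ k))
  -- the incompressible σ ∈ D_{h(2m)} of length 2m is some M_j(1^m 0), j < k
  refuted : (cardD (h (m + m)) ≤ k) ×
            (∃ λ σ → (σ ∈D h (m + m)) × (length σ ≡ m + m) × Incompressible U c σ) → ⊥
  refuted (|D|≤k , σ , σ∈ , |σ|≡2m , incompressible) =
    let (j , j<|D| , runsM) = machine-covers hc h hc-computes m σ σ∈ in
    tooShort ≤-refl (subst (λ n → n ∸ c ≤ totalLength ρ k + suc m) |σ|≡2m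
      (shortDescription U (machine hc) ρ simulates {c = c} {σ = σ} (≤-trans j<|D| |D|≤k) runsM incompressible))
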